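{- Let $\mathcal{F}$ be a $(70,22)$-minihyper in $\operatorname{PG}(4,3)$. Then for every solid $S$ of $\operatorname{PG}(4,3)$ one has $\mathcal{F}(S)\equiv 1\pmod 3$.
   Context: A multiset in $\operatorname{PG}(r,q)$ is a map $\mathcal{K}$ from the point set to the non-negative integers; for a set of points $\mathcal{Q}$, $\mathcal{K}(\mathcal{Q})=\sum_{P\in\mathcal{Q}}\mathcal{K}(P)$. An $(n,w)$-minihyper in $\operatorname{PG}(r,q)$ is a multiset $\mathcal{K}$ with $\mathcal{K}(\text{all points})=n$, $\mathcal{K}(H)\ge w$ for every hyperplane $H$, and $\mathcal{K}(H_0)=w$ for some hyperplane $H_0$. A solid in $\operatorname{PG}(4,3)$ is a 3-dimensional subspace. -}

module Defs where

open import Data.Nat using (ℕ; zero; suc; _+_; _*_; _≥_; _%_)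
open import Data.Nat.Properties using (_≟_)
open import Data.Bool using (Bool; true; false; T; if_then_else_)
open import Data.Fin using (Fin; toℕ) renaming (zero to fz; suc to fs)
open import Data.Vec using (Vec; []; _∷_; zipWith; foldr)
open import Data.List using (List; []; _∷_; concatMap; map; mapMaybe; filter)
open import Data.Maybe using (Maybe; just; nothing)
open import Data.Product using (Σ; _,_; proj₁; ∃; _×_)
open import Relation.Binary.PropositionalEquality using (_≡_; subst; sym)
open import Data.Unit using (tt)
open import Data.Nat.ListAction using (sum)
open import Relation.Nullary using (does)

F₃ : Set
F₃ = Fin 3

V : Set
V = Vec F₃ 5

allF₃ : List F₃
allF₃ = fz ∷ fs fz ∷ fs (fs fz) ∷ []

allVec : (n : ℕ) → List (Vec F₃ n)
allVec zero = [] ∷ []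
allVec (suc n) = concatMap (λ x → map (x ∷_) (allVec n)) allF₃

-- A vector is a canonical point representative iff its first nonzero
-- coordinate equals 1 (so the zero vector is excluded).  Every projective
-- point of PG(n-1,3) has exactly one such representative.
normalized : {n : ℕ} → Vec F₃ n → Bool
normalized [] = false
normalized (x ∷ v) with toℕ x
... | 0 = normalized v
... | 1 = true
... | _ = false

Point : Set
Point = Σ V (λ v → T (normalized v))

toPoint : V → Maybe Point
toPoint v with normalized v in eq
... | true = just (v , subst T (sym eq) tt)
... | false = nothing

allPoints : List Point
allPoints = mapMaybe toPoint (allVec 5)

dot : V → V → ℕ
dot a v = foldr (λ _ → ℕ) _+_ 0 (zipWith (λ x y → toℕ x * toℕ y) a v) % 3

PointSet : Set
PointSet = Point → Bool

-- The hyperplane of PG(4,3) with (normalized, hence nonzero) coordinate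
-- vector a:  { P : a · P = 0 }.  Every hyperplane arises this way.
hyperplane : Point → PointSet
hyperplane (a , _) (v , _) = does (dot a v ≟ 0)

IsHyperplane : PointSet → Set
IsHyperplane H = ∃ λ a → ∀ P → H P ≡ hyperplane a P

-- A solid is a 3-dimensional subspace; in PG(4,3) these are exactly the
-- hyperplanes.
IsSolid : PointSet → Set
IsSolid = IsHyperplane

Multiset : Set
Multiset = Point → ℕ

mass : Multiset → PointSet → ℕ
mass K Q = sum (map K (filter (λ P → T? (Q P)) allPoints))
  where
    open import Relation.Nullary.Decidable using (Dec; yes; no)
    T? : (b : Bool) → Dec (T b)
    T? true = yes _
    T? false = no (λ ())

total : Multiset → ℕ
total K = sum (map K allPoints)

IsMinihyper : ℕ → ℕ → Multiset → Set
IsMinihyper n w K =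
  (total K ≡ n)
  × (∀ H → IsHyperplane H → mass K H ≥ w)
  × (∃ λ H₀ → IsHyperplane H₀ × mass K H₀ ≡ w)

{-# OPTIONS --safe #-}

-- Suppose some hyperplane has mass ≢ 1 (mod 3) and let a be one of least mass m.  For
-- linear forms u and w, the hyperplanes u, w, u + w, u + 2w of a pencil cover its axis four
-- times and every other point once.  In a pencil through a the other three members cannot
-- all have mass ≡ 1 (mod 3), as 70 ≡ 1 ≢ m; so one of them has mass at least m, and
-- 2m ≤ 3 F(π) + 26 for every plane π of a.  Averaging over the planes of a yields one with
-- 3 F(π) ≤ m, so m ≤ 26, i.e. m ∈ {23, 24, 26}.  The pencil count inside a and then inside π
-- bounds every line and then every point of π from below, and averaging the point bound
-- twice over π contradicts F(π) ≤ m / 3.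

module Submission where

open import Defs
open import Data.Nat using (ℕ; _%_)
open import Relation.Binary.PropositionalEquality using (_≡_)

open import Data.Bool using (Bool; true; false; T)
open import Data.Bool.Properties using (T?)
open import Data.Empty using (⊥; ⊥-elim)
open import Data.Fin using (toℕ) renaming (zero to fz; suc to fs)
open import Data.Fin.Properties using (toℕ-fromℕ<)
open import Data.List using (List; []; _∷_; map; filter; drop; length)
open import Data.List.Properties using (filter-≐; map-cong; map-cong-local)
open import Data.List.Relation.Unary.All as All using (All; []; _∷_; all?)
open import Data.List.Relation.Unary.All.Properties using (¬Any⇒All¬)
open import Data.List.Relation.Unary.Any using (any?; satisfied)
open import Data.Nat
  using (suc; _+_; _*_; _∸_; _/_; _≤_; _<_; _≟_; _≤?_; _<?_; z≤n; s≤s; NonZero)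
open import Data.Nat.DivMod
  using (_mod_; m%n<n; m%n%n≡m%n; %-distribˡ-+; %-distribˡ-*; m≡m%n+[m/n]*n; [m+kn]%n≡m%n;
         m<n*o⇒m/o<n; /-monoˡ-≤; m*n/n≡m)
open import Data.Nat.Induction using (<-rec)
open import Data.Nat.ListAction using (sum)
open import Data.Nat.Properties
open import Algebra.Properties.CommutativeSemigroup +-commutativeSemigroup using (interchange)
open import Data.Nat.Tactic.RingSolver using (solve-∀)
open import Data.Product using (∃; _×_; _,_; proj₁; proj₂)
open import Data.Sum using (_⊎_; inj₁; inj₂)
open import Data.Vec using (Vec; []; _∷_; zipWith; foldr; replicate)
open import Function using (_∘_; id)
open import Relation.Binary.PropositionalEquality
  using (_≢_; refl; sym; trans; cong; cong₂; subst; module ≡-Reasoning)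
open import Relation.Nullary using (yes; no; does)
open import Relation.Nullary.Decidable using (from-yes)

module _ {A : Set} where

  sum-map-+ : (f g : A → ℕ) (xs : List A) →
              sum (map (λ x → f x + g x) xs) ≡ sum (map f xs) + sum (map g xs)
  sum-map-+ f g []       = refl
  sum-map-+ f g (x ∷ xs) =
    trans (cong (f x + g x +_) (sum-map-+ f g xs))
          (interchange (f x) (g x) (sum (map f xs)) (sum (map g xs)))

  sum-map-*ˡ : (c : ℕ) (f : A → ℕ) (xs : List A) →
               sum (map (λ x → c * f x) xs) ≡ c * sum (map f xs)
  sum-map-*ˡ c f []       = sym (*-zeroʳ c)
  sum-map-*ˡ c f (x ∷ xs) =
    trans (cong (c * f x +_) (sum-map-*ˡ c f xs)) (sym (*-distribˡ-+ c (f x) (sum (map f xs))))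

  sum-map-≥ : (f : A → ℕ) {c : ℕ} (xs : List A) →
              All (λ x → c ≤ f x) xs → length xs * c ≤ sum (map f xs)
  sum-map-≥ f []       []         = z≤n
  sum-map-≥ f (x ∷ xs) (c≤ ∷ c≤s) = +-mono-≤ c≤ (sum-map-≥ f xs c≤s)

  sum-map-<⇒∃≤ : (f : A → ℕ) (c : ℕ) (xs : List A) →
                 sum (map f xs) < length xs * suc c → ∃ λ x → f x ≤ c
  sum-map-<⇒∃≤ f c xs sum< with any? (λ x → f x ≤? c) xs
  ... | yes some = satisfied some
  ... | no none  = ⊥-elim (≤⇒≯ (sum-map-≥ f xs (All.map ≰⇒> (¬Any⇒All¬ xs none))) sum<)

sum-map-swap : {A B : Set} (f : A → B → ℕ) (xs : List A) (ys : List B) →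
               sum (map (λ x → sum (map (f x) ys)) xs) ≡ sum (map (λ y → sum (map (λ x → f x y) xs)) ys)
sum-map-swap f []       ys = sym (sum-zeros ys)
  where
  sum-zeros : ∀ {B : Set} (ys : List B) → sum (map (λ _ → 0) ys) ≡ 0
  sum-zeros []       = refl
  sum-zeros (_ ∷ ys) = sum-zeros ys
sum-map-swap f (x ∷ xs) ys =
  trans (cong (sum (map (f x) ys) +_) (sum-map-swap f xs ys))
        (sym (sum-map-+ (f x) (λ y → sum (map (λ x′ → f x′ y) xs)) ys))

𝟙 : Bool → ℕ
𝟙 true  = 1
𝟙 false = 0

sum-map-filter : {A : Set} (f : A → ℕ) (Q : A → Bool) (xs : List A) →
                 sum (map f (filter (T? ∘ Q) xs)) ≡ sum (map (λ x → f x * 𝟙 (Q x)) xs)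
sum-map-filter f Q []       = refl
sum-map-filter f Q (x ∷ xs) with Q x
... | true  = cong₂ _+_ (sym (*-identityʳ (f x))) (sum-map-filter f Q xs)
... | false = trans (sum-map-filter f Q xs)
                    (cong (_+ sum (map (λ x → f x * 𝟙 (Q x)) xs)) (sym (*-zeroʳ (f x))))

mass-as-sum : (F : Multiset) (Q : PointSet) → mass F Q ≡ sum (map (λ P → F P * 𝟙 (Q P)) allPoints)
mass-as-sum F Q = trans mass≡ (sum-map-filter F Q allPoints)
  where
  p₁ : Point
  p₁ = (fz ∷ fz ∷ fz ∷ fz ∷ fs fz ∷ [] , _)

  -- `mass` filters with a decision procedure local to Defs; unification can recover it only
  -- once the head of the enumeration is decided and its tail abstracted.
  mass≡ : mass F Q ≡ sum (map F (filter (T? ∘ Q) allPoints))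
  mass≡ with drop 1 allPoints | Q p₁
  ... | ps | true  = cong (λ qs → F p₁ + sum (map F qs)) (filter-≐ _ (T? ∘ Q) (id , id) ps)
  ... | ps | false = cong (sum ∘ map F) (filter-≐ _ (T? ∘ Q) (id , id) ps)

mass-cong : (F : Multiset) {Q Q′ : PointSet} → (∀ P → Q P ≡ Q′ P) → mass F Q ≡ mass F Q′
mass-cong F {Q} {Q′} Q≗Q′ =
  trans (mass-as-sum F Q)
        (trans (cong sum (map-cong (λ P → cong (λ q → F P * 𝟙 q) (Q≗Q′ P)) allPoints))
               (sym (mass-as-sum F Q′)))

%-absorbˡ-* : ∀ m o n .{{_ : NonZero n}} → (m % n * o) % n ≡ (m * o) % n
%-absorbˡ-* m o n = begin
  (m % n * o) % n           ≡⟨ %-distribˡ-* (m % n) o n ⟩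
  (m % n % n * (o % n)) % n ≡⟨ cong (λ x → (x * (o % n)) % n) (m%n%n≡m%n m n) ⟩
  (m % n * (o % n)) % n     ≡⟨ %-distribˡ-* m o n ⟨
  (m * o) % n               ∎
  where open ≡-Reasoning

⌈_/3⌉ : ℕ → ℕ
⌈ n /3⌉ = (n + 2) / 3

⌈/3⌉-least : ∀ {n x} → n ≤ 3 * x → ⌈ n /3⌉ ≤ x
⌈/3⌉-least {n} {x} n≤3x = ≤-pred (m<n*o⇒m/o<n {n + 2} {suc x} {3} (s≤s (begin
  n + 2      ≤⟨ +-monoˡ-≤ 2 n≤3x ⟩
  3 * x + 2  ≡⟨ +-comm (3 * x) 2 ⟩
  2 + 3 * x  ≡⟨ cong (2 +_) (*-comm 3 x) ⟩
  2 + x * 3  ∎)))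
  where open ≤-Reasoning

≤⌊/3⌋ : ∀ {n x} → 3 * x ≤ n → x ≤ n / 3
≤⌊/3⌋ {n} {x} 3x≤n =
  subst (_≤ n / 3) (m*n/n≡m x 3) (/-monoˡ-≤ 3 (subst (_≤ n) (*-comm 3 x) 3x≤n))

_+₃_ : F₃ → F₃ → F₃
x +₃ y = (toℕ x + toℕ y) mod 3

_⊕_ : ∀ {n} → Vec F₃ n → Vec F₃ n → Vec F₃ n
_⊕_ = zipWith _+₃_

dotℕ : ∀ {n} → Vec F₃ n → Vec F₃ n → ℕ
dotℕ a v = foldr (λ _ → ℕ) _+_ 0 (zipWith (λ x y → toℕ x * toℕ y) a v)

dotℕ-⊕ : ∀ {n} (u w v : Vec F₃ n) → dotℕ (u ⊕ w) v % 3 ≡ (dotℕ u v + dotℕ w v) % 3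
dotℕ-⊕ []      []      []      = refl
dotℕ-⊕ (x ∷ u) (y ∷ w) (p ∷ v) = begin
  (toℕ (x +₃ y) * toℕ p + dotℕ (u ⊕ w) v) % 3
    ≡⟨ %-distribˡ-+ (toℕ (x +₃ y) * toℕ p) (dotℕ (u ⊕ w) v) 3 ⟩
  ((toℕ (x +₃ y) * toℕ p) % 3 + dotℕ (u ⊕ w) v % 3) % 3
    ≡⟨ cong₂ (λ s t → (s + t) % 3) coordinate (dotℕ-⊕ u w v) ⟩
  ((toℕ x * toℕ p + toℕ y * toℕ p) % 3 + (dotℕ u v + dotℕ w v) % 3) % 3
    ≡⟨ %-distribˡ-+ (toℕ x * toℕ p + toℕ y * toℕ p) (dotℕ u v + dotℕ w v) 3 ⟨
  (toℕ x * toℕ p + toℕ y * toℕ p + (dotℕ u v + dotℕ w v)) % 3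
    ≡⟨ cong (_% 3) (interchange (toℕ x * toℕ p) (toℕ y * toℕ p) (dotℕ u v) (dotℕ w v)) ⟩
  (toℕ x * toℕ p + dotℕ u v + (toℕ y * toℕ p + dotℕ w v)) % 3 ∎
  where
  open ≡-Reasoning

  coordinate : (toℕ (x +₃ y) * toℕ p) % 3 ≡ (toℕ x * toℕ p + toℕ y * toℕ p) % 3
  coordinate = begin
    (toℕ (x +₃ y) * toℕ p) % 3
      ≡⟨ cong (λ z → (z * toℕ p) % 3) (toℕ-fromℕ< (m%n<n (toℕ x + toℕ y) 3)) ⟩
    ((toℕ x + toℕ y) % 3 * toℕ p) % 3 ≡⟨ %-absorbˡ-* (toℕ x + toℕ y) (toℕ p) 3 ⟩
    ((toℕ x + toℕ y) * toℕ p) % 3     ≡⟨ cong (_% 3) (*-distribʳ-+ (toℕ p) (toℕ x) (toℕ y)) ⟩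
    (toℕ x * toℕ p + toℕ y * toℕ p) % 3 ∎

dotℕ-zeroˡ : ∀ {n} (v : Vec F₃ n) → dotℕ (replicate n fz) v ≡ 0
dotℕ-zeroˡ []      = refl
dotℕ-zeroˡ (_ ∷ v) = dotℕ-zeroˡ v

dot-⊕ : (u w v : V) → dot (u ⊕ w) v ≡ (dot u v + dot w v) % 3
dot-⊕ u w v = trans (dotℕ-⊕ u w v) (%-distribˡ-+ (dotℕ u v) (dotℕ w v) 3)

dot<3 : (u v : V) → dot u v < 3
dot<3 u v = m%n<n (dotℕ u v) 3

normalized-cases : ∀ {n} (t : Vec F₃ n) →
                   T (normalized t) ⊎ T (normalized (t ⊕ t)) ⊎ t ≡ replicate n fz
normalized-cases []               = inj₂ (inj₂ refl)
normalized-cases (fz ∷ t) with normalized-cases t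
... | inj₁ t-normal          = inj₁ t-normal
... | inj₂ (inj₁ 2t-normal)  = inj₂ (inj₁ 2t-normal)
... | inj₂ (inj₂ refl)       = inj₂ (inj₂ refl)
normalized-cases (fs fz ∷ t)      = inj₁ _
normalized-cases (fs (fs fz) ∷ t) = inj₂ (inj₁ _)

δ₀ : ℕ → ℕ
δ₀ n = 𝟙 (does (n ≟ 0))

-- x, y, x + y, x + 2y are the four points of PG(1, 3), so exactly one of them vanishes
-- unless x = y = 0.
δ₀-pencil : ∀ {x y} → x < 3 → y < 3 →
            δ₀ x + δ₀ y + δ₀ ((x + y) % 3) + δ₀ ((x + (y + y) % 3) % 3) ≡ 1 + 3 * (δ₀ x * δ₀ y)
δ₀-pencil {0} {0} _ _ = refl
δ₀-pencil {0} {1} _ _ = refl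
δ₀-pencil {0} {2} _ _ = refl
δ₀-pencil {1} {0} _ _ = refl
δ₀-pencil {1} {1} _ _ = refl
δ₀-pencil {1} {2} _ _ = refl
δ₀-pencil {2} {0} _ _ = refl
δ₀-pencil {2} {1} _ _ = refl
δ₀-pencil {2} {2} _ _ = refl
δ₀-pencil {suc (suc (suc _))} (s≤s (s≤s (s≤s ()))) _
δ₀-pencil {_} {suc (suc (suc _))} _ (s≤s (s≤s (s≤s ())))

δ₀-double : ∀ {x} → x < 3 → δ₀ ((x + x) % 3) ≡ δ₀ x
δ₀-double {0} _ = refl
δ₀-double {1} _ = refl
δ₀-double {2} _ = refl
δ₀-double {suc (suc (suc _))} (s≤s (s≤s (s≤s ())))

ker : V → Point → ℕ
ker y P = δ₀ (dot y (proj₁ P))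

ker-pencil : ∀ u w P →
             ker u P + ker w P + ker (u ⊕ w) P + ker (u ⊕ (w ⊕ w)) P ≡ 1 + 3 * (ker u P * ker w P)
ker-pencil u w (v , _) = begin
  δ₀ x + δ₀ y + δ₀ (dot (u ⊕ w) v) + δ₀ (dot (u ⊕ (w ⊕ w)) v)
    ≡⟨ cong₂ (λ s t → δ₀ x + δ₀ y + δ₀ s + δ₀ t)
             (dot-⊕ u w v)
             (trans (dot-⊕ u (w ⊕ w) v) (cong (λ z → (x + z) % 3) (dot-⊕ w w v))) ⟩
  δ₀ x + δ₀ y + δ₀ ((x + y) % 3) + δ₀ ((x + (y + y) % 3) % 3)
    ≡⟨ δ₀-pencil (dot<3 u v) (dot<3 w v) ⟩
  1 + 3 * (δ₀ x * δ₀ y) ∎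
  where
  open ≡-Reasoning

  x y : ℕ
  x = dot u v
  y = dot w v

ker-double : ∀ y P → ker (y ⊕ y) P ≡ ker y P
ker-double y (v , _) = trans (cong δ₀ (dot-⊕ y y v)) (δ₀-double (dot<3 y v))

ker-zero : ∀ P → ker (replicate 5 fz) P ≡ 1
ker-zero (v , _) = cong (λ z → δ₀ (z % 3)) (dotℕ-zeroˡ v)

kernel-count : All (λ P → sum (map (λ y → ker y P) (allVec 5)) ≡ 81) allPoints
kernel-count = from-yes (all? (λ P → sum (map (λ y → ker y P) (allVec 5)) ≟ 81) allPoints)

-- Masses of flats

-- Indicator of the intersection of the y⊥ for y ∈ ys; the y need be neither independent
-- nor nonzero.
flat : List V → Point → ℕ
flat []       _ = 1
flat (y ∷ ys) P = ker y P * flat ys P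

flatMass : Multiset → List V → ℕ
flatMass F ys = sum (map (λ P → F P * flat ys P) allPoints)

flatMass-[] : (F : Multiset) → flatMass F [] ≡ total F
flatMass-[] F = cong sum (map-cong (λ P → *-identityʳ (F P)) allPoints)

mass-hyperplane : (F : Multiset) (a : Point) → mass F (hyperplane a) ≡ flatMass F (proj₁ a ∷ [])
mass-hyperplane F a =
  trans (mass-as-sum F (hyperplane a))
        (cong sum (map-cong (λ P → cong (F P *_) (sym (*-identityʳ (ker (proj₁ a) P)))) allPoints))

flatMass-double : (F : Multiset) (y : V) (ys : List V) → flatMass F (y ⊕ y ∷ ys) ≡ flatMass F (y ∷ ys)
flatMass-double F y ys =
  cong sum (map-cong (λ P → cong (λ k → F P * (k * flat ys P)) (ker-double y P)) allPoints)

flatMass-zero : (F : Multiset) (ys : List V) → flatMass F (replicate 5 fz ∷ ys) ≡ flatMass F ys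
flatMass-zero F ys =
  cong sum (map-cong (λ P → cong (F P *_) (trans (cong (_* flat ys P) (ker-zero P))
                                                  (*-identityˡ (flat ys P))))
                     allPoints)

hyperplane-or-total : (F : Multiset) (t : V) →
                      (∃ λ a → flatMass F (t ∷ []) ≡ mass F (hyperplane a))
                      ⊎ flatMass F (t ∷ []) ≡ total F
hyperplane-or-total F t with normalized-cases t
... | inj₁ t-normal         = inj₁ ((t , t-normal) , sym (mass-hyperplane F (t , t-normal)))
... | inj₂ (inj₁ 2t-normal) = inj₁ ((t ⊕ t , 2t-normal) ,
                                    trans (sym (flatMass-double F t []))
                                          (sym (mass-hyperplane F (t ⊕ t , 2t-normal))))
... | inj₂ (inj₂ refl)      = inj₂ (trans (flatMass-zero F []) (flatMass-[] F))

flatMass-pencil : (F : Multiset) (ys : List V) (u w : V) →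
  flatMass F (u ∷ ys) + flatMass F (w ∷ ys) + flatMass F (u ⊕ w ∷ ys) + flatMass F (u ⊕ (w ⊕ w) ∷ ys)
  ≡ flatMass F ys + 3 * flatMass F (u ∷ w ∷ ys)
flatMass-pencil F ys u w = begin
  Σ (term u) + Σ (term w) + Σ (term (u ⊕ w)) + Σ (term (u ⊕ (w ⊕ w)))
    ≡⟨ cong (λ s → s + Σ (term (u ⊕ w)) + Σ (term (u ⊕ (w ⊕ w))))
            (sum-map-+ (term u) (term w) allPoints) ⟨
  Σ (λ P → term u P + term w P) + Σ (term (u ⊕ w)) + Σ (term (u ⊕ (w ⊕ w)))
    ≡⟨ cong (_+ Σ (term (u ⊕ (w ⊕ w))))
            (sum-map-+ (λ P → term u P + term w P) (term (u ⊕ w)) allPoints) ⟨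
  Σ (λ P → term u P + term w P + term (u ⊕ w) P) + Σ (term (u ⊕ (w ⊕ w)))
    ≡⟨ sum-map-+ (λ P → term u P + term w P + term (u ⊕ w) P) (term (u ⊕ (w ⊕ w))) allPoints ⟨
  Σ (λ P → term u P + term w P + term (u ⊕ w) P + term (u ⊕ (w ⊕ w)) P)
    ≡⟨ cong sum (map-cong pointwise allPoints) ⟩
  Σ (λ P → F P * flat ys P + 3 * (F P * flat (u ∷ w ∷ ys) P))
    ≡⟨ sum-map-+ (λ P → F P * flat ys P) (λ P → 3 * (F P * flat (u ∷ w ∷ ys) P)) allPoints ⟩
  flatMass F ys + Σ (λ P → 3 * (F P * flat (u ∷ w ∷ ys) P))
    ≡⟨ cong (flatMass F ys +_) (sum-map-*ˡ 3 (λ P → F P * flat (u ∷ w ∷ ys) P) allPoints) ⟩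
  flatMass F ys + 3 * flatMass F (u ∷ w ∷ ys) ∎
  where
  open ≡-Reasoning

  Σ : (Point → ℕ) → ℕ
  Σ f = sum (map f allPoints)

  term : V → Point → ℕ
  term y P = F P * flat (y ∷ ys) P

  factor : ∀ m d a b c e →
           m * (a * d) + m * (b * d) + m * (c * d) + m * (e * d) ≡ (m * d) * (a + b + c + e)
  factor = solve-∀

  expand : ∀ m d a b → (m * d) * (1 + 3 * (a * b)) ≡ m * d + 3 * (m * (a * (b * d)))
  expand = solve-∀

  pointwise : ∀ P → term u P + term w P + term (u ⊕ w) P + term (u ⊕ (w ⊕ w)) P
                    ≡ F P * flat ys P + 3 * (F P * flat (u ∷ w ∷ ys) P)
  pointwise P = begin
    term u P + term w P + term (u ⊕ w) P + term (u ⊕ (w ⊕ w)) P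
      ≡⟨ factor (F P) (flat ys P) (ker u P) (ker w P) (ker (u ⊕ w) P) (ker (u ⊕ (w ⊕ w)) P) ⟩
    (F P * flat ys P) * (ker u P + ker w P + ker (u ⊕ w) P + ker (u ⊕ (w ⊕ w)) P)
      ≡⟨ cong (F P * flat ys P *_) (ker-pencil u w P) ⟩
    (F P * flat ys P) * (1 + 3 * (ker u P * ker w P))
      ≡⟨ expand (F P) (flat ys P) (ker u P) (ker w P) ⟩
    F P * flat ys P + 3 * (F P * flat (u ∷ w ∷ ys) P) ∎

flatMass-average : (F : Multiset) (ys : List V) →
                   sum (map (λ y → flatMass F (y ∷ ys)) (allVec 5)) ≡ 81 * flatMass F ys
flatMass-average F ys = begin
  sum (map (λ y → sum (map (λ P → F P * flat (y ∷ ys) P) allPoints)) (allVec 5))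
    ≡⟨ sum-map-swap (λ y P → F P * flat (y ∷ ys) P) (allVec 5) allPoints ⟩
  sum (map (λ P → sum (map (λ y → F P * flat (y ∷ ys) P) (allVec 5))) allPoints)
    -- f and g are explicit: inferring them would evaluate both sums over all points.
    ≡⟨ cong sum (map-cong-local {f = λ P → sum (map (λ y → F P * flat (y ∷ ys) P) (allVec 5))}
                                {g = λ P → 81 * (F P * flat ys P)}
                                (All.map at-point kernel-count)) ⟩
  sum (map (λ P → 81 * (F P * flat ys P)) allPoints)
    ≡⟨ sum-map-*ˡ 81 (λ P → F P * flat ys P) allPoints ⟩
  81 * flatMass F ys ∎
  where
  open ≡-Reasoning

  rearrange : ∀ m k d → m * (k * d) ≡ (m * d) * k
  rearrange = solve-∀

  at-point : ∀ {P} → sum (map (λ y → ker y P) (allVec 5)) ≡ 81 →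
             sum (map (λ y → F P * flat (y ∷ ys) P) (allVec 5)) ≡ 81 * (F P * flat ys P)
  at-point {P} count = begin
    sum (map (λ y → F P * flat (y ∷ ys) P) (allVec 5))
      ≡⟨ cong sum (map-cong (λ y → rearrange (F P) (ker y P) (flat ys P)) (allVec 5)) ⟩
    sum (map (λ y → (F P * flat ys P) * ker y P) (allVec 5))
      ≡⟨ sum-map-*ˡ (F P * flat ys P) (λ y → ker y P) (allVec 5) ⟩
    (F P * flat ys P) * sum (map (λ y → ker y P) (allVec 5))
      ≡⟨ cong (F P * flat ys P *_) count ⟩
    (F P * flat ys P) * 81
      ≡⟨ *-comm (F P * flat ys P) 81 ⟩
    81 * (F P * flat ys P) ∎

flatMass-section-≥ : ∀ {c} (F : Multiset) (ys : List V) →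
                     (∀ y → c ≤ flatMass F (y ∷ ys)) → 3 * c ≤ flatMass F ys
flatMass-section-≥ {c} F ys c≤ = *-cancelˡ-≤ 81 (begin
  81 * (3 * c)
    ≡⟨ *-assoc 81 3 c ⟨
  length (allVec 5) * c
    ≤⟨ sum-map-≥ (λ y → flatMass F (y ∷ ys)) (allVec 5) (All.tabulate (λ {y} _ → c≤ y)) ⟩
  sum (map (λ y → flatMass F (y ∷ ys)) (allVec 5))
    ≡⟨ flatMass-average F ys ⟩
  81 * flatMass F ys ∎)
  where open ≤-Reasoning

∃-light-section : (F : Multiset) (ys : List V) → ∃ λ y → 3 * flatMass F (y ∷ ys) ≤ flatMass F ys
∃-light-section F ys =
  sum-map-<⇒∃≤ (λ y → 3 * flatMass F (y ∷ ys)) (flatMass F ys) (allVec 5) (begin-strict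
    sum (map (λ y → 3 * flatMass F (y ∷ ys)) (allVec 5))
      ≡⟨ sum-map-*ˡ 3 (λ y → flatMass F (y ∷ ys)) (allVec 5) ⟩
    3 * sum (map (λ y → flatMass F (y ∷ ys)) (allVec 5))
      ≡⟨ cong (3 *_) (flatMass-average F ys) ⟩
    3 * (81 * flatMass F ys)
      ≡⟨ *-assoc 3 81 (flatMass F ys) ⟨
    243 * flatMass F ys
      <⟨ *-monoʳ-< 243 (n<1+n (flatMass F ys)) ⟩
    243 * suc (flatMass F ys) ∎)
  where open ≤-Reasoning

pencil-bound : ∀ {c B} (F : Multiset) (ys : List V) →
              (∀ y → c ≤ flatMass F (y ∷ ys)) → flatMass F ys ≤ B →
              ∀ u w → ⌈ 4 * c ∸ B /3⌉ ≤ flatMass F (u ∷ w ∷ ys)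
pencil-bound {c} {B} F ys c≤ μ≤B u w = ⌈/3⌉-least (m≤n+o⇒m∸n≤o (4 * c) B (begin
  4 * c                          ≡⟨ four-times c ⟩
  c + c + c + c                  ≤⟨ +-mono-≤ (+-mono-≤ (+-mono-≤ (c≤ u) (c≤ w)) (c≤ (u ⊕ w)))
                                             (c≤ (u ⊕ (w ⊕ w))) ⟩
  μ (u ∷ ys) + μ (w ∷ ys) + μ (u ⊕ w ∷ ys) + μ (u ⊕ (w ⊕ w) ∷ ys)
                                 ≡⟨ flatMass-pencil F ys u w ⟩
  μ ys + 3 * μ (u ∷ w ∷ ys)      ≤⟨ +-monoˡ-≤ (3 * μ (u ∷ w ∷ ys)) μ≤B ⟩
  B + 3 * μ (u ∷ w ∷ ys)         ∎))
  where
  open ≤-Reasoning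

  μ : List V → ℕ
  μ = flatMass F

  four-times : ∀ c → 4 * c ≡ c + c + c + c
  four-times = solve-∀

-- A hyperplane of least mass ≢ 1 (mod 3)

Admissible : ℕ → ℕ → Set
Admissible m x = 22 ≤ x × (x % 3 ≢ 1 → m ≤ x)

admissible-sum : ∀ {m x y z} → Admissible m x → Admissible m y → Admissible m z →
                 (x % 3 ≡ 1 × y % 3 ≡ 1 × z % 3 ≡ 1) ⊎ m + 44 ≤ x + y + z
admissible-sum {m} {x} {y} {z} (22≤x , m≤x) (22≤y , m≤y) (22≤z , m≤z)
  with x % 3 ≟ 1 | y % 3 ≟ 1 | z % 3 ≟ 1
... | yes x≡1 | yes y≡1 | yes z≡1 = inj₁ (x≡1 , y≡1 , z≡1)
... | no x≢1  | _       | _       =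
  inj₂ (subst (_≤ x + y + z) (+-assoc m 22 22) (+-mono-≤ (+-mono-≤ (m≤x x≢1) 22≤y) 22≤z))
... | yes _   | no y≢1  | _       =
  inj₂ (subst (_≤ x + y + z) (trans (cong (_+ 22) (+-comm 22 m)) (+-assoc m 22 22))
              (+-mono-≤ (+-mono-≤ 22≤x (m≤y y≢1)) 22≤z))
... | yes _   | yes _   | no z≢1  =
  inj₂ (subst (_≤ x + y + z) (+-comm 44 m) (+-mono-≤ (+-mono-≤ 22≤x 22≤y) (m≤z z≢1)))

pencil-residue : ∀ m k x y z → x % 3 ≡ 1 → y % 3 ≡ 1 → z % 3 ≡ 1 →
                 x + m + y + z ≡ 70 + 3 * k → m % 3 ≡ 1
pencil-residue m k x y z x≡1 y≡1 z≡1 sum≡ = begin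
  m % 3                                           ≡⟨ [m+kn]%n≡m%n m (1 + x / 3 + y / 3 + z / 3) 3 ⟨
  (m + (1 + x / 3 + y / 3 + z / 3) * 3) % 3       ≡⟨ cong (_% 3) (regroup m (x / 3) (y / 3) (z / 3)) ⟩
  ((1 + x / 3 * 3) + m + (1 + y / 3 * 3) + (1 + z / 3 * 3)) % 3
    ≡⟨ cong (_% 3) (cong₂ _+_ (cong₂ _+_ (cong (_+ m) (decompose x x≡1)) (decompose y y≡1))
                              (decompose z z≡1)) ⟨
  (x + m + y + z) % 3                             ≡⟨ cong (_% 3) (trans sum≡ (70+3k k)) ⟩
  (1 + (23 + k) * 3) % 3                          ≡⟨ [m+kn]%n≡m%n 1 (23 + k) 3 ⟩
  1                                               ∎
  where
  open ≡-Reasoning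

  decompose : ∀ n → n % 3 ≡ 1 → n ≡ 1 + n / 3 * 3
  decompose n n≡1 = trans (m≡m%n+[m/n]*n n 3) (cong (_+ n / 3 * 3) n≡1)

  regroup : ∀ m a b c → m + (1 + a + b + c) * 3 ≡ (1 + a * 3) + m + (1 + b * 3) + (1 + c * 3)
  regroup = solve-∀

  70+3k : ∀ k → 70 + 3 * k ≡ 1 + (23 + k) * 3
  70+3k = solve-∀

admissible-pencil-bound : ∀ {m k x y z} → m % 3 ≢ 1 →
                          Admissible m x → Admissible m y → Admissible m z →
                          x + m + y + z ≡ 70 + 3 * k → 2 * m ≤ 3 * k + 26
admissible-pencil-bound {m} {k} {x} {y} {z} m≢1 adm-x adm-y adm-z sum≡
  with admissible-sum adm-x adm-y adm-z
... | inj₁ (x≡1 , y≡1 , z≡1) = ⊥-elim (m≢1 (pencil-residue m k x y z x≡1 y≡1 z≡1 sum≡))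
... | inj₂ m+44≤             = +-cancelʳ-≤ 44 (2 * m) (3 * k + 26) (begin
  2 * m + 44          ≡⟨ regroupˡ m ⟩
  m + (m + 44)        ≤⟨ +-monoʳ-≤ m m+44≤ ⟩
  m + (x + y + z)     ≡⟨ regroupʳ m x y z ⟩
  x + m + y + z       ≡⟨ sum≡ ⟩
  70 + 3 * k          ≡⟨ trans (+-comm 70 (3 * k)) (sym (+-assoc (3 * k) 26 44)) ⟩
  3 * k + 26 + 44     ∎)
  where
  open ≤-Reasoning

  regroupˡ : ∀ m → 2 * m + 44 ≡ m + (m + 44)
  regroupˡ = solve-∀

  regroupʳ : ∀ m x y z → m + (x + y + z) ≡ x + m + y + z
  regroupʳ = solve-∀

planeBound lineBound pointBound : ℕ → ℕ
planeBound m = ⌈ 2 * m ∸ 26 /3⌉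
lineBound  m = ⌈ 4 * planeBound m ∸ m /3⌉
pointBound m = ⌈ 4 * lineBound m ∸ m / 3 /3⌉

m/3<9*pointBound : ∀ {m} → 22 ≤ m → m ≤ 26 → m % 3 ≢ 1 → m / 3 < 9 * pointBound m
m/3<9*pointBound {m} 22≤m m≤26 =
  subst Clash (m∸n+n≡m 22≤m) (clash (m ∸ 22) (∸-monoˡ-≤ 22 m≤26))
  where
  Clash : ℕ → Set
  Clash m = m % 3 ≢ 1 → m / 3 < 9 * pointBound m

  clash : ∀ k → k ≤ 4 → Clash (k + 22)
  clash 0 _ 22≢1 = ⊥-elim (22≢1 refl)
  clash 1 _ _    = from-yes (7 <? 9)
  clash 2 _ _    = from-yes (8 <? 18)
  clash 3 _ 25≢1 = ⊥-elim (25≢1 refl)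
  clash 4 _ _    = from-yes (8 <? 27)
  clash (suc (suc (suc (suc (suc _))))) (s≤s (s≤s (s≤s (s≤s ())))) _

module MinimalCounterexample
  (F : Multiset) (total≡70 : total F ≡ 70) (22≤mass : ∀ a → 22 ≤ mass F (hyperplane a))
  (a : Point) (m≢1 : mass F (hyperplane a) % 3 ≢ 1)
  (minimal : ∀ a′ → mass F (hyperplane a′) % 3 ≢ 1 → mass F (hyperplane a) ≤ mass F (hyperplane a′))
  where

  m : ℕ
  m = mass F (hyperplane a)

  α : V
  α = proj₁ a

  μ : List V → ℕ
  μ = flatMass F

  μ[α]≡m : μ (α ∷ []) ≡ m
  μ[α]≡m = sym (mass-hyperplane F a)

  μ[]≡70 : μ [] ≡ 70
  μ[]≡70 = trans (flatMass-[] F) total≡70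

  admissible : ∀ t → Admissible m (μ (t ∷ []))
  admissible t with hyperplane-or-total F t
  ... | inj₁ (a′ , μ≡) = subst (Admissible m) (sym μ≡) (22≤mass a′ , minimal a′)
  ... | inj₂ μ≡total   = subst (Admissible m) (sym (trans μ≡total total≡70))
                               (from-yes (22 ≤? 70) , λ 70≢1 → ⊥-elim (70≢1 refl))

  plane-inequality : ∀ y → 2 * m ≤ 3 * μ (y ∷ α ∷ []) + 26
  plane-inequality y =
    admissible-pencil-bound {k = μ (y ∷ α ∷ [])} m≢1
      (admissible y) (admissible (y ⊕ α)) (admissible (y ⊕ (α ⊕ α))) (begin
      μ (y ∷ []) + m + μ (y ⊕ α ∷ []) + μ (y ⊕ (α ⊕ α) ∷ [])
        ≡⟨ cong (λ s → μ (y ∷ []) + s + μ (y ⊕ α ∷ []) + μ (y ⊕ (α ⊕ α) ∷ [])) μ[α]≡m ⟨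
      μ (y ∷ []) + μ (α ∷ []) + μ (y ⊕ α ∷ []) + μ (y ⊕ (α ⊕ α) ∷ [])
        ≡⟨ flatMass-pencil F [] y α ⟩
      μ [] + 3 * μ (y ∷ α ∷ [])
        ≡⟨ cong (_+ 3 * μ (y ∷ α ∷ [])) {μ []} {70} μ[]≡70 ⟩
      70 + 3 * μ (y ∷ α ∷ []) ∎)
    where open ≡-Reasoning

  plane-bound : ∀ y → planeBound m ≤ μ (y ∷ α ∷ [])
  plane-bound y =
    ⌈/3⌉-least (m≤n+o⇒m∸n≤o (2 * m) 26 (subst (2 * m ≤_) (+-comm _ 26) (plane-inequality y)))

  b : V
  b = proj₁ (∃-light-section F (α ∷ []))

  light : 3 * μ (b ∷ α ∷ []) ≤ m
  light = subst (3 * μ (b ∷ α ∷ []) ≤_) μ[α]≡m (proj₂ (∃-light-section F (α ∷ [])))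

  m≤26 : m ≤ 26
  m≤26 = +-cancelˡ-≤ m m 26 (begin
    m + m                       ≡⟨ cong (m +_) (+-identityʳ m) ⟨
    2 * m                       ≤⟨ plane-inequality b ⟩
    3 * μ (b ∷ α ∷ []) + 26     ≤⟨ +-monoˡ-≤ 26 light ⟩
    m + 26                      ∎)
    where open ≤-Reasoning

  line-bound : ∀ u → lineBound m ≤ μ (u ∷ b ∷ α ∷ [])
  line-bound u = pencil-bound F (α ∷ []) plane-bound (≤-reflexive μ[α]≡m) u b

  point-bound : ∀ u v → pointBound m ≤ μ (u ∷ v ∷ b ∷ α ∷ [])
  point-bound = pencil-bound F (b ∷ α ∷ []) line-bound (≤⌊/3⌋ light)

  9*pointBound≤plane : 9 * pointBound m ≤ μ (b ∷ α ∷ [])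
  9*pointBound≤plane = subst (_≤ μ (b ∷ α ∷ [])) (sym (*-assoc 3 3 (pointBound m)))
    (flatMass-section-≥ F (b ∷ α ∷ [])
      (λ v → flatMass-section-≥ F (v ∷ b ∷ α ∷ []) (λ u → point-bound u v)))

  absurd : ⊥
  absurd = <⇒≱ (m/3<9*pointBound (22≤mass a) m≤26 m≢1) (≤-trans 9*pointBound≤plane (≤⌊/3⌋ light))

hyperplane-mass-≡1 : (F : Multiset) → total F ≡ 70 → (∀ a → 22 ≤ mass F (hyperplane a)) →
                     ∀ a → mass F (hyperplane a) % 3 ≡ 1
hyperplane-mass-≡1 F total≡70 22≤mass a = <-rec Claim step (mass F (hyperplane a)) a refl
  where
  Claim : ℕ → Set
  Claim n = ∀ a → mass F (hyperplane a) ≡ n → mass F (hyperplane a) % 3 ≡ 1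

  step : ∀ n → (∀ {k} → k < n → Claim k) → Claim n
  step _ ih a refl with mass F (hyperplane a) % 3 ≟ 1
  ... | yes ≡1 = ≡1
  ... | no ≢1  = ⊥-elim (MinimalCounterexample.absurd F total≡70 22≤mass a ≢1 minimal)
    where
    minimal : ∀ a′ → mass F (hyperplane a′) % 3 ≢ 1 → mass F (hyperplane a) ≤ mass F (hyperplane a′)
    minimal a′ ≢1′ = ≮⇒≥ (λ lighter → ≢1′ (ih lighter a′ refl))

lemma4p5 : (F : Multiset) → IsMinihyper 70 22 F →
    (S : PointSet) → IsSolid S → mass F S % 3 ≡ 1
lemma4p5 F (total≡70 , 22≤mass , _) S (a , S≗a) =
  trans (cong (_% 3) (mass-cong F S≗a))
        (hyperplane-mass-≡1 F total≡70 (λ a → 22≤mass (hyperplane a) (a , λ _ → refl)) a)
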